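{- Let $n \ge 2$ be an integer and $\Sigma = \{0,1,\dots,n-1\}$. Let $T_n$ be the number of integer arrays $\pi$ of length $n$ such that $\pi = \pi_x$ for some word $x \in \Sigma^n$. Then $T_n \le B_n$, where $B_n$ is the $n$th Bell number (the number of partitions of an $n$-element set).
   Context: For a finite alphabet $\Sigma$, two words over $\Sigma$ of equal length are abelian equivalent if every letter of $\Sigma$ occurs the same number of times in both. An abelian border of a word $w$ is a proper prefix of $w$ (a prefix different from $w$, possibly empty) that is abelian equivalent to the suffix of $w$ of the same length. For a word $x$ of length $n$, the abelian border array $\pi_x$ is the array of length $n$ with $\pi_x[i]$ ($1\le i\le n$) equal to the length of the longest abelian border of the prefix $x[1]\cdots x[i]$. -}

module Defs where

open import Data.Nat using (ℕ; zero; suc; _+_; _*_; _∸_; _⊔_; _<_; _<?_)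
open import Data.Nat.Properties using () renaming (_≟_ to _≟ℕ_)
open import Data.Fin using (Fin)
open import Data.Fin.Properties using (all?) renaming (_≟_ to _≟F_)
open import Data.List using (allFin; List; []; _∷_; length; filter; map; take; drop; upTo; foldr; concatMap; deduplicate)
open import Data.List.Properties using (≡-dec)
open import Data.Nat.ListAction using (sum)
open import Relation.Binary.PropositionalEquality using (_≡_)
open import Relation.Nullary using (Dec)

Word : ℕ → Set
Word n = List (Fin n)

occ : ∀ {n} → Fin n → Word n → ℕ
occ a w = length (filter (a ≟F_) w)

AbelianEquiv : ∀ {n} → Word n → Word n → Set
AbelianEquiv {n} u v = (a : Fin n) → occ a u ≡ occ a v

abelianEquiv? : ∀ {n} (u v : Word n) → Dec (AbelianEquiv u v)
abelianEquiv? u v = all? (λ a → occ a u ≟ℕ occ a v)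

IsAbelianBorder : ∀ {n} → Word n → ℕ → Set
IsAbelianBorder w l = AbelianEquiv (take l w) (drop (length w ∸ l) w)

isAbelianBorder? : ∀ {n} (w : Word n) (l : ℕ) → Dec (IsAbelianBorder w l)
isAbelianBorder? w l = abelianEquiv? (take l w) (drop (length w ∸ l) w)

longestAbelianBorder : ∀ {n} → Word n → ℕ
longestAbelianBorder w = foldr _⊔_ 0 (filter (isAbelianBorder? w) (upTo (length w)))

-- abelian border array π_x : entry i (1 ≤ i ≤ |x|) is the longest abelian
-- border of the prefix x[1..i]; stored as a list of length |x|
abelianBorderArray : ∀ {n} → Word n → List ℕ
abelianBorderArray x = map (λ i → longestAbelianBorder (take (suc i) x)) (upTo (length x))

allFinList : (n : ℕ) → List (Fin n)
allFinList n = allFin n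

wordsOfLength : (n k : ℕ) → List (Word n)
wordsOfLength n zero = [] ∷ []
wordsOfLength n (suc k) = concatMap (λ a → map (a ∷_) (wordsOfLength n k)) (allFinList n)

T : ℕ → ℕ
T n = length (deduplicate (≡-dec _≟ℕ_) (map abelianBorderArray (wordsOfLength n n)))

stirling2 : ℕ → ℕ → ℕ
stirling2 zero zero = 1
stirling2 zero (suc k) = 0
stirling2 (suc n) zero = 0
stirling2 (suc n) (suc k) = suc k * stirling2 n (suc k) + stirling2 n k

bell : ℕ → ℕ
bell n = sum (map (stirling2 n) (upTo (suc n)))

{-# OPTIONS --safe #-}
-- Renaming the letters of a word by a map that is injective on the letters it
-- uses preserves the letter counts of all its factors, hence its abelian border
-- array. So π_x depends only on the partition of the positions of x into letter
-- classes, which we encode by numbering the letters of x in order of appearance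
-- from the right. Words of length n with k letters have S(n, k) such encodings,
-- as they satisfy the Stirling recurrence, so at most B_n arrays occur.
module Submission where

open import Defs
open import Data.Nat using (ℕ; zero; suc; _+_; _*_; _∸_; _⊔_; _<_; _≤_; z≤n; s≤s; NonZero)
open import Data.Nat.Properties
  using (≤-trans; ≤-reflexive; <-≤-trans; <-irrefl; n<1+n; m≤n⇒m≤1+n; m<n⇒m<1+n; *-comm)
  renaming (_≟_ to _≟ℕ_)
open import Data.Nat.DivMod using (_mod_; m%n<n; m<n⇒m%n≡m)
open import Data.Nat.ListAction using (sum)
open import Data.Fin using (Fin; toℕ)
open import Data.Fin.Properties using (toℕ-fromℕ<) renaming (_≟_ to _≟F_)
open import Data.List
  using (List; []; _∷_; [_]; _++_; length; map; filter; take; drop; foldr; upTo; concatMap; deduplicate)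
open import Data.List.Properties
  using ( length-map; length-++; length-++-sucʳ; length-upTo; map-∘; map-cong; map-cong-local
        ; take-map; drop-map; filter-none; filter-≐; ≡-dec)
open import Data.List.Relation.Unary.All as All using (All; []; _∷_)
open import Data.List.Relation.Unary.All.Properties using (take⁺; drop⁺; ¬Any⇒All¬)
open import Data.List.Relation.Unary.Any as Any using (here; there; any?)
open import Data.List.Relation.Unary.AllPairs using ([]; _∷_)
open import Data.List.Relation.Unary.Unique.Propositional using (Unique)
open import Data.List.Relation.Unary.Unique.DecPropositional.Properties (≡-dec _≟ℕ_) using (deduplicate-!)
open import Data.List.Relation.Binary.Subset.Propositional using (_⊆_)
open import Data.List.Membership.Propositional using (_∈_; _∉_)
open import Data.List.Membership.Propositional.Properties
  using ( ∈-map⁺; ∈-map⁻; ∈-++⁺ˡ; ∈-++⁺ʳ; ∈-++⁻; ∈-∃++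
        ; ∈-concatMap⁺; ∈-concatMap⁻; ∈-upTo⁺; ∈-deduplicate⁻)
open import Data.Product using (_,_)
open import Data.Sum using (inj₁; inj₂)
open import Function using (_∘_; _⇔_; mk⇔; Equivalence)
open Equivalence using (to; from)
open import Relation.Binary.PropositionalEquality
  using (_≡_; refl; sym; trans; cong; cong₂; subst; subst₂; module ≡-Reasoning)
open import Relation.Nullary using (yes; no; contradiction)
open import Relation.Unary using (Pred; _≐_)
import Level

InjectiveOn : ∀ {a b ℓ} {A : Set a} {B : Set b} → Pred A ℓ → (A → B) → Set (a Level.⊔ b Level.⊔ ℓ)
InjectiveOn P g = ∀ {b c} → P b → P c → g b ≡ g c → b ≡ c

occ-∉ : ∀ {n} {a : Fin n} {w} → a ∉ w → occ a w ≡ 0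
occ-∉ {w = w} a∉w = cong length (filter-none (_ ≟F_) (¬Any⇒All¬ w a∉w))

module _ {m k ℓ} {P : Pred (Fin m) ℓ} {g : Fin m → Fin k} (g-inj : InjectiveOn P g) where

  occ-map : ∀ {c u} → P c → All P u → occ (g c) (map g u) ≡ occ c u
  occ-map pc [] = refl
  occ-map {c} {b ∷ u} pc (pb ∷ pu) with g c ≟F g b | c ≟F b
  ... | yes _   | yes _   = cong suc (occ-map pc pu)
  ... | yes gc≡gb | no c≢b = contradiction (g-inj pc pb gc≡gb) c≢b
  ... | no gc≢gb | yes c≡b = contradiction (cong g c≡b) gc≢gb
  ... | no _    | no _    = occ-map pc pu

  module _ {u v : Word m} (pu : All P u) (pv : All P v) where

    occ-map-≡ : ∀ {c} → P c → occ (g c) (map g u) ≡ occ (g c) (map g v) ⇔ occ c u ≡ occ c v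
    occ-map-≡ pc = mk⇔ (subst₂ _≡_ (occ-map pc pu) (occ-map pc pv))
                       (subst₂ _≡_ (sym (occ-map pc pu)) (sym (occ-map pc pv)))

    abelianEquiv-map⁺ : AbelianEquiv u v → AbelianEquiv (map g u) (map g v)
    abelianEquiv-map⁺ u∼v a with any? (a ≟F_) (map g u) | any? (a ≟F_) (map g v)
    ... | yes a∈gu | _ with c , c∈u , refl ← ∈-map⁻ g a∈gu =
      from (occ-map-≡ (All.lookup pu c∈u)) (u∼v c)
    ... | no _ | yes a∈gv with c , c∈v , refl ← ∈-map⁻ g a∈gv =
      from (occ-map-≡ (All.lookup pv c∈v)) (u∼v c)
    ... | no a∉gu | no a∉gv = trans (occ-∉ a∉gu) (sym (occ-∉ a∉gv))

    abelianEquiv-map⁻ : AbelianEquiv (map g u) (map g v) → AbelianEquiv u v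
    abelianEquiv-map⁻ gu∼gv c with any? (c ≟F_) u | any? (c ≟F_) v
    ... | yes c∈u | _ = to (occ-map-≡ (All.lookup pu c∈u)) (gu∼gv (g c))
    ... | no _ | yes c∈v = to (occ-map-≡ (All.lookup pv c∈v)) (gu∼gv (g c))
    ... | no c∉u | no c∉v = trans (occ-∉ c∉u) (sym (occ-∉ c∉v))

  isAbelianBorder-map : ∀ {w} → All P w → IsAbelianBorder (map g w) ≐ IsAbelianBorder w
  isAbelianBorder-map {w} pw =
      (λ {l} → abelianEquiv-map⁻ (pre l) (suf l) ∘ subst₂ AbelianEquiv (prefix l) (suffix l))
    , (λ {l} → subst₂ AbelianEquiv (sym (prefix l)) (sym (suffix l)) ∘ abelianEquiv-map⁺ (pre l) (suf l))
    where
    pre : ∀ l → All P (take l w)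
    pre l = take⁺ l pw
    suf : ∀ l → All P (drop (length w ∸ l) w)
    suf l = drop⁺ (length w ∸ l) pw
    prefix : ∀ l → take l (map g w) ≡ map g (take l w)
    prefix l = take-map l w
    suffix : ∀ l → drop (length (map g w) ∸ l) (map g w) ≡ map g (drop (length w ∸ l) w)
    suffix l = trans (cong (λ n → drop (n ∸ l) (map g w)) (length-map g w)) (drop-map (length w ∸ l) w)

  longestAbelianBorder-map : ∀ {w} → All P w → longestAbelianBorder (map g w) ≡ longestAbelianBorder w
  longestAbelianBorder-map {w} pw = cong (foldr _⊔_ 0) (begin
    filter (isAbelianBorder? (map g w)) (upTo (length (map g w)))
      ≡⟨ cong (filter (isAbelianBorder? (map g w)) ∘ upTo) (length-map g w) ⟩
    filter (isAbelianBorder? (map g w)) (upTo (length w))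
      ≡⟨ filter-≐ (isAbelianBorder? (map g w)) (isAbelianBorder? w) (isAbelianBorder-map pw) (upTo (length w)) ⟩
    filter (isAbelianBorder? w) (upTo (length w)) ∎)
    where open ≡-Reasoning

  abelianBorderArray-map : ∀ {x} → All P x → abelianBorderArray (map g x) ≡ abelianBorderArray x
  abelianBorderArray-map {x} px rewrite length-map g x = map-cong prefixBorder (upTo (length x))
    where
    prefixBorder : ∀ i → longestAbelianBorder (take (suc i) (map g x)) ≡ longestAbelianBorder (take (suc i) x)
    prefixBorder i rewrite take-map {f = g} (suc i) x = longestAbelianBorder-map (take⁺ (suc i) px)

distinctLetters : ∀ {n} → Word n → ℕ
distinctLetters [] = 0
distinctLetters (a ∷ xs) with any? (a ≟F_) xs
... | yes _ = distinctLetters xs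
... | no _  = suc (distinctLetters xs)

-- Scanning x from the right, each letter is numbered 0, 1, … when first met.
rank : ∀ {n} → Word n → Fin n → ℕ
rank [] b = 0
rank (a ∷ xs) b with any? (a ≟F_) xs | b ≟F a
... | yes _ | _     = rank xs b
... | no _  | yes _ = distinctLetters xs
... | no _  | no _  = rank xs b

distinctLetters≤length : ∀ {n} (x : Word n) → distinctLetters x ≤ length x
distinctLetters≤length [] = z≤n
distinctLetters≤length (a ∷ xs) with any? (a ≟F_) xs
... | yes _ = m≤n⇒m≤1+n (distinctLetters≤length xs)
... | no _  = s≤s (distinctLetters≤length xs)

rank-∷ : ∀ {n} (a : Fin n) {xs b} → b ∈ xs → rank (a ∷ xs) b ≡ rank xs b
rank-∷ a {xs} {b} b∈xs with any? (a ≟F_) xs | b ≟F a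
... | yes _   | _      = refl
... | no a∉xs | yes refl = contradiction b∈xs a∉xs
... | no _    | no _   = refl

rank<distinctLetters : ∀ {n} {x : Word n} {b} → b ∈ x → rank x b < distinctLetters x
rank<distinctLetters {x = a ∷ xs} {b} b∈x with any? (a ≟F_) xs | b ≟F a | b∈x
... | yes a∈xs | _       | here refl  = rank<distinctLetters a∈xs
... | yes _    | _       | there b∈xs = rank<distinctLetters b∈xs
... | no _     | yes _   | _          = n<1+n _
... | no _     | no b≢a  | here b≡a   = contradiction b≡a b≢a
... | no _     | no _    | there b∈xs = m≤n⇒m≤1+n (rank<distinctLetters b∈xs)

rank-injective : ∀ {n} (x : Word n) → InjectiveOn (_∈ x) (rank x)
rank-injective (a ∷ xs) {b} {c} b∈x c∈x rb≡rc with any? (a ≟F_) xs | b ≟F a | c ≟F a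
... | yes a∈xs | _        | _        = rank-injective xs (inTail b∈x) (inTail c∈x) rb≡rc
  where
  inTail : ∀ {d} → d ∈ a ∷ xs → d ∈ xs
  inTail (here refl) = a∈xs
  inTail (there d∈xs) = d∈xs
... | no _ | yes refl | yes refl = refl
... | no _ | yes refl | no c≢a   =
  contradiction (rank<distinctLetters (Any.tail c≢a c∈x)) (<-irrefl (sym rb≡rc))
... | no _ | no b≢a   | yes refl =
  contradiction (rank<distinctLetters (Any.tail b≢a b∈x)) (<-irrefl rb≡rc)
... | no _ | no b≢a   | no c≢a   = rank-injective xs (Any.tail b≢a b∈x) (Any.tail c≢a c∈x) rb≡rc

shape : ∀ {n} → Word n → List ℕ
shape x = map (rank x) x

prependBelow : ℕ → List ℕ → List (List ℕ)
prependBelow k r = map (_∷ r) (upTo k)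

length-prependBelow : ∀ k r → length (prependBelow k r) ≡ k
length-prependBelow k r = trans (length-map (_∷ r) (upTo k)) (length-upTo k)

-- Read from the right, each entry is either one of the k letters seen so far or
-- the next new one; the two cases give the two terms of the Stirling recurrence.
shapes : ℕ → ℕ → List (List ℕ)
shapes zero    zero    = [ [] ]
shapes zero    (suc k) = []
shapes (suc n) zero    = []
shapes (suc n) (suc k) =
  concatMap (prependBelow (suc k)) (shapes n (suc k)) ++ map (k ∷_) (shapes n k)

∷-old∈shapes : ∀ {n k r j} → r ∈ shapes n k → j < k → j ∷ r ∈ shapes (suc n) k
∷-old∈shapes {k = suc k} {r} r∈ j<k =
  ∈-++⁺ˡ (∈-concatMap⁺ (prependBelow (suc k))
           (Any.map (λ { refl → ∈-map⁺ (_∷ r) (∈-upTo⁺ j<k) }) r∈))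

∷-new∈shapes : ∀ {n k r} → r ∈ shapes n k → k ∷ r ∈ shapes (suc n) (suc k)
∷-new∈shapes {n} {k} r∈ =
  ∈-++⁺ʳ (concatMap (prependBelow (suc k)) (shapes n (suc k))) (∈-map⁺ (k ∷_) r∈)

shape-∷ : ∀ {n} (a : Fin n) xs → shape (a ∷ xs) ≡ rank (a ∷ xs) a ∷ shape xs
shape-∷ a xs = cong (rank (a ∷ xs) a ∷_) (map-cong-local (All.tabulate (rank-∷ a)))

shape∈shapes : ∀ {n} (x : Word n) → shape x ∈ shapes (length x) (distinctLetters x)
shape∈shapes [] = here refl
shape∈shapes (a ∷ xs) rewrite shape-∷ a xs with any? (a ≟F_) xs | a ≟F a
... | yes a∈xs | _     = ∷-old∈shapes (shape∈shapes xs) (rank<distinctLetters a∈xs)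
... | no _     | yes _ = ∷-new∈shapes {length xs} (shape∈shapes xs)
... | no _     | no a≢a = contradiction refl a≢a

length-concatMap : ∀ {a b} {A : Set a} {B : Set b} (f : A → List B) xs →
                   length (concatMap f xs) ≡ sum (map (length ∘ f) xs)
length-concatMap f []       = refl
length-concatMap f (x ∷ xs) = trans (length-++ (f x)) (cong (length (f x) +_) (length-concatMap f xs))

length-concatMap-const : ∀ {a b} {A : Set a} {B : Set b} (f : A → List B) {c} →
                         (∀ x → length (f x) ≡ c) → ∀ xs → length (concatMap f xs) ≡ length xs * c
length-concatMap-const f fc []       = refl
length-concatMap-const f fc (x ∷ xs) = trans (length-++ (f x)) (cong₂ _+_ (fc x) (length-concatMap-const f fc xs))

length-shapes : ∀ n k → length (shapes n k) ≡ stirling2 n k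
length-shapes zero    zero    = refl
length-shapes zero    (suc k) = refl
length-shapes (suc n) zero    = refl
length-shapes (suc n) (suc k) = begin
  length (concatMap (prependBelow (suc k)) (shapes n (suc k)) ++ map (k ∷_) (shapes n k))
    ≡⟨ length-++ (concatMap (prependBelow (suc k)) (shapes n (suc k))) ⟩
  length (concatMap (prependBelow (suc k)) (shapes n (suc k))) + length (map (k ∷_) (shapes n k))
    ≡⟨ cong₂ _+_ (length-concatMap-const (prependBelow (suc k)) (length-prependBelow (suc k)) (shapes n (suc k)))
                 (length-map (k ∷_) (shapes n k)) ⟩
  length (shapes n (suc k)) * suc k + length (shapes n k)
    ≡⟨ cong₂ _+_ (*-comm (length (shapes n (suc k))) (suc k)) refl ⟩
  suc k * length (shapes n (suc k)) + length (shapes n k)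
    ≡⟨ cong₂ (λ s t → suc k * s + t) (length-shapes n (suc k)) (length-shapes n k) ⟩
  suc k * stirling2 n (suc k) + stirling2 n k ∎
  where open ≡-Reasoning

allShapes : ℕ → List (List ℕ)
allShapes n = concatMap (shapes n) (upTo (suc n))

length-allShapes : ∀ n → length (allShapes n) ≡ bell n
length-allShapes n =
  trans (length-concatMap (shapes n) (upTo (suc n))) (cong sum (map-cong (length-shapes n) (upTo (suc n))))

shape∈allShapes : ∀ {n} (x : Word n) → shape x ∈ allShapes (length x)
shape∈allShapes x = ∈-concatMap⁺ (shapes (length x))
  (Any.map (λ { refl → shape∈shapes x }) (∈-upTo⁺ (s≤s (distinctLetters≤length x))))

toℕ-mod : ∀ {a n} .{{_ : NonZero n}} → a < n → toℕ (a mod n) ≡ a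
toℕ-mod {a} {n} a<n = trans (toℕ-fromℕ< (m%n<n a n)) (m<n⇒m%n≡m a<n)

-- A shape is read as a word over an alphabet with one more letter than its
-- length, which keeps the alphabet nonempty.
shapeArray : List ℕ → List ℕ
shapeArray r = abelianBorderArray (map (_mod suc (length r)) r)

abelianBorderArray-shape : ∀ {n} (x : Word n) → abelianBorderArray x ≡ shapeArray (shape x)
abelianBorderArray-shape {n} x = sym (begin
  abelianBorderArray (map (_mod N) (map (rank x) x))
    ≡⟨ cong abelianBorderArray (map-∘ x) ⟨
  abelianBorderArray (map relabel x)
    ≡⟨ abelianBorderArray-map relabel-injective (All.tabulate (λ b∈x → b∈x)) ⟩
  abelianBorderArray x ∎)
  where
  open ≡-Reasoning
  N : ℕ
  N = suc (length (shape x))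
  relabel : Fin n → Fin N
  relabel = (_mod N) ∘ rank x
  rank<N : ∀ {b} → b ∈ x → rank x b < N
  rank<N b∈x = m<n⇒m<1+n (<-≤-trans (rank<distinctLetters b∈x)
                 (≤-trans (distinctLetters≤length x) (≤-reflexive (sym (length-map (rank x) x)))))
  relabel-injective : InjectiveOn (_∈ x) relabel
  relabel-injective {b} {c} b∈x c∈x eq = rank-injective x b∈x c∈x (begin
    rank x b          ≡⟨ toℕ-mod (rank<N b∈x) ⟨
    toℕ (relabel b)   ≡⟨ cong toℕ eq ⟩
    toℕ (relabel c)   ≡⟨ toℕ-mod (rank<N c∈x) ⟩
    rank x c          ∎)

length-wordsOfLength : ∀ n k {x} → x ∈ wordsOfLength n k → length x ≡ k
length-wordsOfLength n zero    (here refl) = refl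
length-wordsOfLength n (suc k) x∈
  with a , x∈a∷ ← Any.satisfied
                    (∈-concatMap⁻ (λ a → map (a ∷_) (wordsOfLength n k)) {xs = allFinList n} x∈)
  with w , w∈ , refl ← ∈-map⁻ (a ∷_) x∈a∷ = cong suc (length-wordsOfLength n k w∈)

Unique-⊆⇒length≤ : ∀ {a} {A : Set a} {xs ys : List A} → Unique xs → xs ⊆ ys → length xs ≤ length ys
Unique-⊆⇒length≤ {xs = []} [] _ = z≤n
Unique-⊆⇒length≤ {xs = x ∷ xs} (x∉xs ∷ !xs) xs⊆ys
  with us , vs , refl ← ∈-∃++ (xs⊆ys (here refl)) =
  ≤-trans (s≤s (Unique-⊆⇒length≤ !xs xs⊆us++vs)) (≤-reflexive (sym (length-++-sucʳ us x vs)))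
  where
  xs⊆us++vs : xs ⊆ us ++ vs
  xs⊆us++vs {z} z∈xs with ∈-++⁻ us (xs⊆ys (there z∈xs))
  ... | inj₁ z∈us         = ∈-++⁺ˡ z∈us
  ... | inj₂ (here refl)  = contradiction refl (All.lookup x∉xs z∈xs)
  ... | inj₂ (there z∈vs) = ∈-++⁺ʳ us z∈vs

abelianBorderArrays⊆shapeArrays : ∀ n k →
  deduplicate (≡-dec _≟ℕ_) (map abelianBorderArray (wordsOfLength n k)) ⊆ map shapeArray (allShapes k)
abelianBorderArrays⊆shapeArrays n k π∈
  with x , x∈ , refl ← ∈-map⁻ abelianBorderArray (∈-deduplicate⁻ (≡-dec _≟ℕ_) _ π∈) =
  subst (_∈ map shapeArray (allShapes k)) (sym (abelianBorderArray-shape x))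
    (∈-map⁺ shapeArray
      (subst (λ k → shape x ∈ allShapes k) (length-wordsOfLength n k x∈) (shape∈allShapes x)))

#abelianBorderArrays≤bell : ∀ n k →
  length (deduplicate (≡-dec _≟ℕ_) (map abelianBorderArray (wordsOfLength n k))) ≤ bell k
#abelianBorderArrays≤bell n k =
  ≤-trans (Unique-⊆⇒length≤ (deduplicate-! _) (abelianBorderArrays⊆shapeArrays n k))
          (≤-reflexive (trans (length-map shapeArray (allShapes k)) (length-allShapes k)))

-- The bound holds for every n.
mainTheorem11 : (n : ℕ) → 2 ≤ n → T n ≤ bell n
mainTheorem11 n _ = #abelianBorderArrays≤bell n n
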